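{- Let $\alpha\in\mathbb{N}_0^N$ with $N=\ell(\alpha)+|\alpha|$, $\upsilon=\frac1{N+1}$, $\widetilde{\alpha}_i=\alpha_i-i\upsilon$, and $w$ the permutation of $\{1,\ldots,N\}$ with $r(\alpha,w(i))=i$. Fix an integer $n$ with $1\le n\le\alpha_{w(1)}$, let $m:=L(\alpha;w(1),\alpha_{w(1)}+1-n)+1$, put $\xi_{mk+i}:=\widetilde{\alpha}_{w(i)}-nk$ ($1\le i\le m$, $k\ge0$), and let $T\ge1$ be the unique integer with $\widetilde{\alpha}_{w(m+s)}<\xi_{m+s+1}$ for $1\le s<T$ and $\widetilde{\alpha}_{w(m+T)}>\xi_{m+T+1}$. Suppose that for some $s>T$ we have $\widetilde{\alpha}_{w(m+s)}-\xi_{m+s+1}>0$ and $\widetilde{\alpha}_{w(m+s+1)}-\xi_{m+s+2}<0$. Write $m+s+1=ml+i$ with $1\le i\le m$. Then the hook-length at the node $(w(i),\alpha_{w(i)}+1-nl)$ is $l(m\kappa+n)$, i.e. $h(\alpha,\kappa+1;w(i),\alpha_{w(i)}+1-nl)=l(m\kappa+n)$ (equivalently $L(\alpha;w(i),\alpha_{w(i)}+1-nl)=ml-1$).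
   Context: $\mathbb{N}_0=\{0,1,2,\ldots\}$, $|\alpha|=\sum_i\alpha_i$, $\ell(\alpha)=\max\{j:\alpha_j>0\}$. Rank: $r(\alpha,i)=\#\{j:\alpha_j>\alpha_i\}+\#\{j:1\le j\le i,\ \alpha_j=\alpha_i\}$. Leg-length: for $1\le i\le\ell(\alpha)$, $1\le j\le\alpha_i$, $L(\alpha;i,j)=\#\{l:l>i,\ j\le\alpha_l\le\alpha_i\}+\#\{l:l<i,\ j\le\alpha_l+1\le\alpha_i\}$. Hook-length: $h(\alpha,t;i,j)=\alpha_i-j+t+\kappa L(\alpha;i,j)$, with $\kappa$ an indeterminate; thus $h(\alpha,\kappa+1;i,j)=(L(\alpha;i,j)+1)\kappa+\alpha_i+1-j$. -}

module Defs where

open import Data.Bool using (Bool; true; false; if_then_else_; _∧_)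
open import Data.Nat using (ℕ; zero; suc; _+_; _*_; _∸_; _≤ᵇ_; _<ᵇ_; _≡ᵇ_; _/_; _%_)
open import Data.Vec using (Vec; []; _∷_)
import Data.Vec as Vec
open import Data.Integer as ℤ using (ℤ; +_)
open import Data.Rational as ℚ using (ℚ)
open import Data.Product using (_×_; _,_)

-- 1-indexed access: at α j = α_j for 1 ≤ j ≤ N, and 0 otherwise.
at : ∀ {N} → Vec ℕ N → ℕ → ℕ
at [] _ = 0
at (x ∷ xs) zero = 0
at (x ∷ xs) (suc zero) = x
at (x ∷ xs) (suc (suc j)) = at xs (suc j)

count : (ℕ → Bool) → ℕ → ℕ
count p zero = 0
count p (suc K) = (if p (suc K) then 1 else 0) + count p K

size : ∀ {N} → Vec ℕ N → ℕ
size = Vec.sum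

ellAux : (ℕ → ℕ) → ℕ → ℕ
ellAux a zero = 0
ellAux a (suc j) = if 0 <ᵇ a (suc j) then suc j else ellAux a j

ell : ∀ {N} → Vec ℕ N → ℕ
ell {N} α = ellAux (at α) N

rank : ∀ {N} → Vec ℕ N → ℕ → ℕ
rank {N} α i =
  count (λ j → at α i <ᵇ at α j) N
  + count (λ j → (j ≤ᵇ i) ∧ (at α j ≡ᵇ at α i)) N

leg : ∀ {N} → Vec ℕ N → ℕ → ℕ → ℕ
leg {N} α i j =
  count (λ l → (i <ᵇ l) ∧ ((j ≤ᵇ at α l) ∧ (at α l ≤ᵇ at α i))) N
  + count (λ l → (l <ᵇ i) ∧ ((j ≤ᵇ suc (at α l)) ∧ (suc (at α l) ≤ᵇ at α i))) N

-- Linear polynomials a + b κ in the indeterminate κ, with integer coefficients: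
-- a pair (a , b) stands for a + b κ.
LinPoly : Set
LinPoly = ℤ × ℤ

hook : ∀ {N} → Vec ℕ N → LinPoly → ℕ → ℕ → LinPoly
hook α (t₀ , t₁) i j =
  ((+ at α i ℤ.- + j) ℤ.+ t₀ , t₁ ℤ.+ + leg α i j)

κ+1 : LinPoly
κ+1 = (+ 1 , + 1)

αt : ∀ {N} → Vec ℕ N → ℕ → ℚ
αt {N} α i = (+ at α i ℚ./ 1) ℚ.- (+ i ℚ./ suc N)

-- ξ_{m k + i} = α̃_{w(i)} − n k  for 1 ≤ i ≤ m, k ≥ 0 (here m = suc M, p ≥ 1);
-- p = m k + i with k = (p − 1) / m and i = (p − 1) % m + 1.
ξ : ∀ {N} → Vec ℕ N → (w : ℕ → ℕ) → (n M p : ℕ) → ℚ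
ξ α w n M p =
  αt α (w (suc ((p ∸ 1) % suc M))) ℚ.- (+ (n * ((p ∸ 1) / suc M)) ℚ./ 1)

{-# OPTIONS --safe #-}
-- Multiplying by N + 1 turns α̃_x − k into the integer (N + 1)(α_x − k) − x, and since
-- 0 < x < N + 1 these integers compare lexicographically on (α_x − k, −x).  Unfolding
-- the definitions, r(α,x) − 1 counts the positions j with α̃_j > α̃_x, and
-- r(α,x) + L(α; x, α_x + 1 − k) those with α̃_j > α̃_x − k.  As w lists the positions in
-- decreasing order of α̃, the two sign hypotheses place α̃_{w(i)} − nl strictly between
-- α̃_{w(m+s+1)} and α̃_{w(m+s)}: for i < m via α̃_{w(i+1)} < α̃_{w(i)}, for i = m via
-- α̃_{w(1)} − n < α̃_{w(m)}, which is how m is defined.  So exactly m + s positions lie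
-- above it, and L = m + s − i = ml − 1.
module Submission where

open import Defs
open import Data.Nat using (ℕ; suc; _+_; _*_; _∸_; _≤_; _<_)
open import Data.Vec using (Vec)
open import Data.Integer using (+_)
open import Data.Rational using (0ℚ; _-_) renaming (_<_ to _<ℚ_; _>_ to _>ℚ_)
open import Data.Product using (_×_; _,_)
open import Relation.Binary.PropositionalEquality using (_≡_)

open import Data.Bool using (Bool; true; false; _∨_; _∧_)
open import Data.Empty using (⊥; ⊥-elim)
open import Data.Integer as ℤ using (ℤ; +<+)
import Data.Integer.Properties as ℤP
open import Data.Integer.Tactic.RingSolver using (solve-∀)
open import Data.Nat using (zero; _≤ᵇ_; _<ᵇ_; _≡ᵇ_; z≤n; s≤s; z<s)
open import Data.Nat.DivMod using (_%_; _/_; [m+kn]%n≡m%n; m<n⇒m%n≡m; +-distrib-/-∣ʳ; m<n⇒m/n≡0; m*n/n≡m)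
open import Data.Nat.Divisibility using (divides)
open import Data.Nat.Properties
import Data.Nat.Tactic.RingSolver as ℕ-Ring
open import Data.Product using (proj₁; proj₂)
open import Data.Product.Relation.Binary.Lex.Strict using (×-Lex)
open import Data.Rational as ℚ using (toℚᵘ)
import Data.Rational.Properties as ℚP
open import Data.Rational.Unnormalised as ℚᵘ using (mkℚᵘ; *≡*; *<*)
import Data.Rational.Unnormalised.Properties as ℚᵘP
open import Data.Sum using (_⊎_; inj₁; inj₂)
import Data.Sum as Sum
open import Function.Base using (_∘_)
open import Function.Bundles using (_⇔_; mk⇔; Equivalence)
open import Relation.Binary.Definitions using (tri<; tri≈; tri>)
open import Relation.Binary.PropositionalEquality
open import Relation.Nullary using (¬_; contradiction; does; proof; yes; no)
open import Relation.Nullary.Reflects using (Reflects; ofʸ; ofⁿ; fromEquivalence; _×-reflects_; _⊎-reflects_)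

_<ₗₑₓ_ : ℕ × ℕ → ℕ × ℕ → Set
_<ₗₑₓ_ = ×-Lex _≡_ _<_ _<_

+-<-*-suc : ∀ {d u} P → u < d → P * d + u < suc P * d
+-<-*-suc {d} {u} P u<d = subst (P * d + u <_) (+-comm (P * d) d) (+-monoʳ-< (P * d) u<d)

*+-<⇔<ₗₑₓ : ∀ {d u v} P Q → u < d → v < d → P * d + u < Q * d + v ⇔ (P , u) <ₗₑₓ (Q , v)
*+-<⇔<ₗₑₓ {d} {u} {v} P Q u<d v<d = mk⇔ to from
  where
  to : P * d + u < Q * d + v → (P , u) <ₗₑₓ (Q , v)
  to lt with <-cmp P Q
  ... | tri< P<Q _ _    = inj₁ P<Q
  ... | tri≈ _ refl _   = inj₂ (refl , +-cancelˡ-< (P * d) u v lt)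
  ... | tri> _ _ Q<P    = contradiction lt (≤⇒≯ (begin
    Q * d + v   ≤⟨ <⇒≤ (+-<-*-suc Q v<d) ⟩
    suc Q * d   ≤⟨ *-monoˡ-≤ d Q<P ⟩
    P * d       ≤⟨ m≤m+n (P * d) u ⟩
    P * d + u   ∎))
    where open ≤-Reasoning
  from : (P , u) <ₗₑₓ (Q , v) → P * d + u < Q * d + v
  from (inj₁ P<Q) = begin-strict
    P * d + u   <⟨ +-<-*-suc P u<d ⟩
    suc P * d   ≤⟨ *-monoˡ-≤ d P<Q ⟩
    Q * d       ≤⟨ m≤m+n (Q * d) v ⟩
    Q * d + v   ∎
    where open ≤-Reasoning
  from (inj₂ (refl , u<v)) = +-monoʳ-< (P * d) u<v

<ₗₑₓ⇒≤ : ∀ {a l c i} → (a , l) <ₗₑₓ (c , i) → a ≤ c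
<ₗₑₓ⇒≤ (inj₁ a<c)       = <⇒≤ a<c
<ₗₑₓ⇒≤ (inj₂ (a≡c , _)) = ≤-reflexive a≡c

<ₗₑₓ-<⇒< : ∀ {a l c i} → i < l → (a , l) <ₗₑₓ (c , i) → a < c
<ₗₑₓ-<⇒< _   (inj₁ a<c)       = a<c
<ₗₑₓ-<⇒< i<l (inj₂ (_ , l<i)) = contradiction l<i (<-asym i<l)

≤-<⇒<ₗₑₓ : ∀ {a l c i} → a ≤ c → l < i → (a , l) <ₗₑₓ (c , i)
≤-<⇒<ₗₑₓ a≤c l<i with m≤n⇒m<n∨m≡n a≤c
... | inj₁ a<c = inj₁ a<c
... | inj₂ a≡c = inj₂ (a≡c , l<i)

+1∸≤⇔<+ : ∀ {a k b} → a + 1 ∸ k ≤ b ⇔ a < k + b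
+1∸≤⇔<+ {a} {k} {b} = mk⇔
  (λ t≤b → subst (_≤ k + b) (+-comm a 1) (≤-trans (m≤n+m∸n (a + 1) k) (+-monoʳ-≤ k t≤b)))
  (λ a<k+b → m≤n+o⇒m∸n≤o (a + 1) k (subst (_≤ k + b) (sym (+-comm a 1)) a<k+b))

rank-condition⇔ : ∀ {i l a b} → (l ≡ i → b ≡ a) →
                  (a < b ⊎ (l ≤ i × b ≡ a)) ⇔ ((a , l) <ₗₑₓ (b , i) ⊎ l ≡ i)
rank-condition⇔ {i} {l} {a} {b} same = mk⇔ to from
  where
  to : a < b ⊎ (l ≤ i × b ≡ a) → (a , l) <ₗₑₓ (b , i) ⊎ l ≡ i
  to (inj₁ a<b)          = inj₁ (inj₁ a<b)
  to (inj₂ (l≤i , b≡a)) with m≤n⇒m<n∨m≡n l≤i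
  ... | inj₁ l<i = inj₁ (inj₂ (sym b≡a , l<i))
  ... | inj₂ l≡i = inj₂ l≡i
  from : (a , l) <ₗₑₓ (b , i) ⊎ l ≡ i → a < b ⊎ (l ≤ i × b ≡ a)
  from (inj₁ (inj₁ a<b))         = inj₁ a<b
  from (inj₁ (inj₂ (a≡b , l<i))) = inj₂ (<⇒≤ l<i , sym a≡b)
  from (inj₂ l≡i)                = inj₂ (≤-reflexive l≡i , same l≡i)

-- The condition for l to be counted in L(α; i, t), where a = α_i and b = α_l.
LegCondition : (i l a b t : ℕ) → Set
LegCondition i l a b t = (i < l × (t ≤ b × b ≤ a)) ⊎ (l < i × (t ≤ suc b × suc b ≤ a))

leg-condition-disjoint : ∀ {i l a b t} → LegCondition i l a b t → ¬ (a , l) <ₗₑₓ (b , i)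
leg-condition-disjoint (inj₁ (_   , _ , b≤a)) (inj₁ a<b)         = <⇒≱ a<b b≤a
leg-condition-disjoint (inj₁ (i<l , _ , b≤a)) (inj₂ (_ , l<i))   = <-asym i<l l<i
leg-condition-disjoint (inj₂ (_ , _ , b<a))   (inj₁ a<b)         = <-asym a<b b<a
leg-condition-disjoint (inj₂ (_ , _ , b<a))   (inj₂ (a≡b , _))   = <-irrefl (sym a≡b) b<a

leg-condition⊎⇒<ₗₑₓ : ∀ {i l a b k} → 1 ≤ k → (l ≡ i → b ≡ a) →
  (LegCondition i l a b (a + 1 ∸ k) ⊎ l ≡ i) ⊎ (a , l) <ₗₑₓ (b , i) → (a , l) <ₗₑₓ (k + b , i)
leg-condition⊎⇒<ₗₑₓ 1≤k _ (inj₁ (inj₁ (inj₁ (_ , t≤b , _)))) = inj₁ (Equivalence.to +1∸≤⇔<+ t≤b)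
leg-condition⊎⇒<ₗₑₓ {a = a} {b} {k} 1≤k _ (inj₁ (inj₁ (inj₂ (l<i , t≤1+b , _)))) =
  ≤-<⇒<ₗₑₓ (≤-pred (subst (a <_) (+-suc k b) (Equivalence.to +1∸≤⇔<+ t≤1+b))) l<i
leg-condition⊎⇒<ₗₑₓ {a = a} {k = k} 1≤k same (inj₁ (inj₂ l≡i)) =
  inj₁ (subst (λ c → a < k + c) (sym (same l≡i)) (m<n+m a 1≤k))
leg-condition⊎⇒<ₗₑₓ {b = b} {k} _ _ (inj₂ (inj₁ a<b))     = inj₁ (<-≤-trans a<b (m≤n+m b k))
leg-condition⊎⇒<ₗₑₓ {a = a} 1≤k _ (inj₂ (inj₂ (refl , _))) = inj₁ (m<n+m a 1≤k)

<ₗₑₓ⇒leg-condition⊎ : ∀ {i l a b k} → 1 ≤ k → (l ≡ i → b ≡ a) →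
  (a , l) <ₗₑₓ (k + b , i) → (LegCondition i l a b (a + 1 ∸ k) ⊎ l ≡ i) ⊎ (a , l) <ₗₑₓ (b , i)
<ₗₑₓ⇒leg-condition⊎ {i} {l} {a} {b} {k} 1≤k same below with <-cmp a b | <-cmp l i
... | tri< a<b _ _  | _            = inj₂ (inj₁ a<b)
... | tri≈ _ a≡b _  | tri< l<i _ _ = inj₂ (inj₂ (a≡b , l<i))
... | tri≈ _ _ _    | tri≈ _ l≡i _ = inj₁ (inj₂ l≡i)
... | tri≈ _ refl _ | tri> _ _ i<l =
  inj₁ (inj₁ (inj₁ (i<l , Equivalence.from +1∸≤⇔<+ (m<n+m a 1≤k) , ≤-refl)))
... | tri> _ _ b<a  | tri≈ _ l≡i _ = contradiction (same l≡i) (<⇒≢ b<a)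
... | tri> _ _ b<a  | tri> _ _ i<l =
  inj₁ (inj₁ (inj₁ (i<l , Equivalence.from +1∸≤⇔<+ (<ₗₑₓ-<⇒< i<l below) , <⇒≤ b<a)))
... | tri> _ _ b<a  | tri< l<i _ _ =
  inj₁ (inj₁ (inj₂ (l<i , Equivalence.from +1∸≤⇔<+ a<k+1+b , b<a)))
  where
  a<k+1+b : a < k + suc b
  a<k+1+b = subst (a <_) (sym (+-suc k b)) (s≤s (<ₗₑₓ⇒≤ below))

≡ᵇ-reflects-≡ : ∀ m n → Reflects (m ≡ n) (m ≡ᵇ n)
≡ᵇ-reflects-≡ m n = fromEquivalence (≡ᵇ⇒≡ m n) (≡⇒≡ᵇ m n)

count-mono : ∀ {P Q : ℕ → Set} {p q : ℕ → Bool} →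
             (∀ j → Reflects (P j) (p j)) → (∀ j → Reflects (Q j) (q j)) →
             ∀ K → (∀ {j} → j ≤ K → P j → Q j) → count p K ≤ count q K
count-mono P? Q? zero    _   = z≤n
count-mono {p = p} {q = q} P? Q? (suc K) P⇒Q with p (suc K) | P? (suc K) | q (suc K) | Q? (suc K)
... | true  | ofʸ Pj | false | ofⁿ ¬Qj = contradiction (P⇒Q ≤-refl Pj) ¬Qj
... | true  | _      | true  | _       = s≤s (count-mono P? Q? K (P⇒Q ∘ m≤n⇒m≤1+n))
... | false | _      | true  | _       = m≤n⇒m≤1+n (count-mono P? Q? K (P⇒Q ∘ m≤n⇒m≤1+n))
... | false | _      | false | _       = count-mono P? Q? K (P⇒Q ∘ m≤n⇒m≤1+n)

count-cong : ∀ {P Q : ℕ → Set} {p q : ℕ → Bool} →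
             (∀ j → Reflects (P j) (p j)) → (∀ j → Reflects (Q j) (q j)) →
             ∀ K → (∀ {j} → j ≤ K → P j ⇔ Q j) → count p K ≡ count q K
count-cong P? Q? K P⇔Q = ≤-antisym (count-mono P? Q? K (Equivalence.to ∘ P⇔Q))
                                   (count-mono Q? P? K (Equivalence.from ∘ P⇔Q))

count-∨ : ∀ {P Q : ℕ → Set} {p q : ℕ → Bool} →
          (∀ j → Reflects (P j) (p j)) → (∀ j → Reflects (Q j) (q j)) →
          ∀ K → (∀ {j} → j ≤ K → P j → Q j → ⊥) → count p K + count q K ≡ count (λ j → p j ∨ q j) K
count-∨ P? Q? zero    _        = refl
count-∨ {p = p} {q = q} P? Q? (suc K) disjoint with p (suc K) | P? (suc K) | q (suc K) | Q? (suc K)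
... | true  | ofʸ Pj | true  | ofʸ Qj = ⊥-elim (disjoint ≤-refl Pj Qj)
... | true  | _      | false | _      = cong suc (count-∨ P? Q? K (disjoint ∘ m≤n⇒m≤1+n))
... | false | _      | true  | _      =
  trans (+-suc (count p K) (count q K)) (cong suc (count-∨ P? Q? K (disjoint ∘ m≤n⇒m≤1+n)))
... | false | _      | false | _      = count-∨ P? Q? K (disjoint ∘ m≤n⇒m≤1+n)

count-≡ᵇ-0 : ∀ {x} K → K < x → count (_≡ᵇ x) K ≡ 0
count-≡ᵇ-0 zero K<x = refl
count-≡ᵇ-0 {x} (suc K) K<x with suc K ≡ᵇ x | ≡ᵇ-reflects-≡ (suc K) x
... | true  | ofʸ refl = contradiction K<x (<-irrefl refl)
... | false | _        = count-≡ᵇ-0 K (<-trans (n<1+n K) K<x)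

count-≡ᵇ : ∀ {x} K → 1 ≤ x → x ≤ K → count (_≡ᵇ x) K ≡ 1
count-≡ᵇ zero (s≤s z≤n) ()
count-≡ᵇ {x} (suc K) 1≤x x≤1+K with suc K ≡ᵇ x | ≡ᵇ-reflects-≡ (suc K) x
... | true  | ofʸ refl = cong suc (count-≡ᵇ-0 K ≤-refl)
... | false | ofⁿ 1+K≢x = count-≡ᵇ K 1≤x (≤-pred (≤∧≢⇒< x≤1+K (1+K≢x ∘ sym)))

ℤ+-cancelʳ-< : ∀ {i j} k → i ℤ.+ k ℤ.< j ℤ.+ k → i ℤ.< j
ℤ+-cancelʳ-< {i} {j} k i+k<j+k = subst₂ ℤ._<_ ([i+k]-k≡i i k) ([i+k]-k≡i j k) (ℤP.+-monoˡ-< (ℤ.- k) i+k<j+k)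
  where
  [i+k]-k≡i : ∀ i k → i ℤ.+ k ℤ.- k ≡ i
  [i+k]-k≡i = solve-∀

p-q+q≡p : ∀ p q → p ℚ.- q ℚ.+ q ≡ p
p-q+q≡p p q = begin
  p ℚ.- q ℚ.+ q       ≡⟨ ℚP.+-assoc p (ℚ.- q) q ⟩
  p ℚ.+ (ℚ.- q ℚ.+ q) ≡⟨ cong (p ℚ.+_) (ℚP.+-inverseˡ q) ⟩
  p ℚ.+ 0ℚ            ≡⟨ ℚP.+-identityʳ p ⟩
  p                   ∎
  where open ≡-Reasoning

0<p-q⇒q<p : ∀ {p q} → 0ℚ ℚ.< p ℚ.- q → q ℚ.< p
0<p-q⇒q<p {p} {q} 0<p-q = subst₂ ℚ._<_ (ℚP.+-identityˡ q) (p-q+q≡p p q) (ℚP.+-monoˡ-< q 0<p-q)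

p-q<0⇒p<q : ∀ {p q} → p ℚ.- q ℚ.< 0ℚ → p ℚ.< q
p-q<0⇒p<q {p} {q} p-q<0 = subst₂ ℚ._<_ (p-q+q≡p p q) (ℚP.+-identityˡ q) (ℚP.+-monoˡ-< q p-q<0)

toℚᵘ-sub : ∀ p q → toℚᵘ (p ℚ.- q) ℚᵘ.≃ toℚᵘ p ℚᵘ.- toℚᵘ q
toℚᵘ-sub p q =
  ℚᵘP.≃-trans (ℚP.toℚᵘ-homo-+ p (ℚ.- q)) (ℚᵘP.+-congʳ (toℚᵘ p) (ℚP.toℚᵘ-homo‿- q))

mkℚᵘ-sub : ∀ i j d → mkℚᵘ i d ℚᵘ.- mkℚᵘ j d ℚᵘ.≃ mkℚᵘ (i ℤ.- j) d
mkℚᵘ-sub i j d = *≡* (ring i j (+ suc d))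
  where
  ring : ∀ i j d → (i ℤ.* d ℤ.+ (ℤ.- j) ℤ.* d) ℤ.* d ≡ (i ℤ.- j) ℤ.* (d ℤ.* d)
  ring = solve-∀

toℚᵘ-integer : ∀ n d → toℚᵘ (+ n ℚ./ 1) ℚᵘ.≃ mkℚᵘ (+ n ℤ.* + suc d) d
toℚᵘ-integer n d = ℚᵘP.≃-trans (ℚP.toℚᵘ-fromℚᵘ (mkℚᵘ (+ n) 0)) (*≡* (ring (+ n) (+ suc d)))
  where
  ring : ∀ n d → n ℤ.* d ≡ n ℤ.* d ℤ.* ℤ.1ℤ
  ring = solve-∀

common-denominator-< : ∀ {p q i j d} → toℚᵘ p ℚᵘ.≃ mkℚᵘ i d → toℚᵘ q ℚᵘ.≃ mkℚᵘ j d →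
                       p ℚ.< q → i ℤ.< j
common-denominator-< {d = d} p≃ q≃ p<q with ℚᵘP.<-respʳ-≃ q≃ (ℚᵘP.<-respˡ-≃ p≃ (ℚP.toℚᵘ-mono-< p<q))
... | *<* i*d<j*d = ℤP.*-cancelʳ-<-nonNeg (+ suc d) i*d<j*d

pos-[l+a]*d+u : ∀ l a d u → + ((l + a) * d + u) ≡ (+ l ℤ.+ + a) ℤ.* + d ℤ.+ + u
pos-[l+a]*d+u l a d u = begin
  + ((l + a) * d + u)               ≡⟨ ℤP.pos-+ ((l + a) * d) u ⟩
  + ((l + a) * d) ℤ.+ + u           ≡⟨ cong (ℤ._+ + u) (ℤP.pos-* (l + a) d) ⟩
  + (l + a) ℤ.* + d ℤ.+ + u         ≡⟨ cong (λ i → i ℤ.* + d ℤ.+ + u) (ℤP.pos-+ l a) ⟩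
  (+ l ℤ.+ + a) ℤ.* + d ℤ.+ + u     ∎
  where open ≡-Reasoning

module _ {N : ℕ} (α : Vec ℕ N) where

  -- scaled x k = (N + 1)(α̃_x − k).  Opaque, so that unification never unfolds it.
  opaque
    scaled : ℕ → ℕ → ℤ
    scaled x k = (+ at α x ℤ.- + k) ℤ.* + suc N ℤ.- + x

    scaled-def : ∀ x k → scaled x k ≡ (+ at α x ℤ.- + k) ℤ.* + suc N ℤ.- + x
    scaled-def x k = refl

  toℚᵘ-αt-shift : ∀ x k → toℚᵘ (αt α x ℚ.- + k ℚ./ 1) ℚᵘ.≃ mkℚᵘ (scaled x k) N
  toℚᵘ-αt-shift x k = begin
    toℚᵘ (αt α x ℚ.- + k ℚ./ 1)
      ≈⟨ toℚᵘ-sub (αt α x) (+ k ℚ./ 1) ⟩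
    toℚᵘ (+ at α x ℚ./ 1 ℚ.- + x ℚ./ suc N) ℚᵘ.- toℚᵘ (+ k ℚ./ 1)
      ≈⟨ ℚᵘP.+-cong (toℚᵘ-sub (+ at α x ℚ./ 1) (+ x ℚ./ suc N)) (ℚᵘP.-‿cong (toℚᵘ-integer k N)) ⟩
    (toℚᵘ (+ at α x ℚ./ 1) ℚᵘ.- toℚᵘ (+ x ℚ./ suc N)) ℚᵘ.- mkℚᵘ (+ k ℤ.* D) N
      ≈⟨ ℚᵘP.+-congˡ (ℚᵘ.- mkℚᵘ (+ k ℤ.* D) N)
                     (ℚᵘP.+-cong (toℚᵘ-integer (at α x) N)
                                 (ℚᵘP.-‿cong (ℚP.toℚᵘ-fromℚᵘ (mkℚᵘ (+ x) N)))) ⟩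
    (mkℚᵘ (+ at α x ℤ.* D) N ℚᵘ.- mkℚᵘ (+ x) N) ℚᵘ.- mkℚᵘ (+ k ℤ.* D) N
      ≈⟨ ℚᵘP.+-congˡ (ℚᵘ.- mkℚᵘ (+ k ℤ.* D) N) (mkℚᵘ-sub (+ at α x ℤ.* D) (+ x) N) ⟩
    mkℚᵘ (+ at α x ℤ.* D ℤ.- + x) N ℚᵘ.- mkℚᵘ (+ k ℤ.* D) N
      ≈⟨ mkℚᵘ-sub (+ at α x ℤ.* D ℤ.- + x) (+ k ℤ.* D) N ⟩
    mkℚᵘ (+ at α x ℤ.* D ℤ.- + x ℤ.- + k ℤ.* D) N
      ≡⟨ cong (λ i → mkℚᵘ i N) (trans (ring (+ at α x) (+ x) (+ k) D) (sym (scaled-def x k))) ⟩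
    mkℚᵘ (scaled x k) N ∎
    where
    open ℚᵘP.≃-Reasoning
    D : ℤ
    D = + suc N
    ring : ∀ a x k d → a ℤ.* d ℤ.- x ℤ.- k ℤ.* d ≡ (a ℤ.- k) ℤ.* d ℤ.- x
    ring = solve-∀

  αt-shift-<⇒scaled-< : ∀ {x k y l} → αt α x ℚ.- + k ℚ./ 1 ℚ.< αt α y ℚ.- + l ℚ./ 1 →
                        scaled x k ℤ.< scaled y l
  αt-shift-<⇒scaled-< {x} {k} {y} {l} = common-denominator-< (toℚᵘ-αt-shift x k) (toℚᵘ-αt-shift y l)

  0<αt-[αt-k]⇒scaled-< : ∀ {x k y} → 0ℚ ℚ.< αt α y ℚ.- (αt α x ℚ.- + k ℚ./ 1) → scaled x k ℤ.< scaled y 0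
  0<αt-[αt-k]⇒scaled-< {x} {k} {y} 0<gap =
    αt-shift-<⇒scaled-< {x} {k} {y} {0} (subst (_ ℚ.<_) (sym (ℚP.+-identityʳ (αt α y))) (0<p-q⇒q<p 0<gap))

  αt-[αt-k]<0⇒scaled-< : ∀ {x k y} → αt α y ℚ.- (αt α x ℚ.- + k ℚ./ 1) ℚ.< 0ℚ → scaled y 0 ℤ.< scaled x k
  αt-[αt-k]<0⇒scaled-< {x} {k} {y} gap<0 =
    αt-shift-<⇒scaled-< {y} {0} {x} {k} (subst (ℚ._< _) (sym (ℚP.+-identityʳ (αt α y))) (p-q<0⇒p<q gap<0))

  scaled-<⇔<ₗₑₓ : ∀ {x k y l} → x ≤ N → y ≤ N →
                  scaled x k ℤ.< scaled y l ⇔ (l + at α x , y) <ₗₑₓ (k + at α y , x)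
  scaled-<⇔<ₗₑₓ {x} {k} {y} {l} x≤N y≤N = mk⇔
    (Equivalence.to lex ∘ ℤP.drop‿+<+ ∘ subst₂ ℤ._<_ offsetˣ offsetʸ ∘ ℤP.+-monoˡ-< c)
    (ℤ+-cancelʳ-< c ∘ subst₂ ℤ._<_ (sym offsetˣ) (sym offsetʸ) ∘ +<+ ∘ Equivalence.from lex)
    where
    D : ℕ
    D = suc N
    c : ℤ
    c = (+ k ℤ.+ + l) ℤ.* + D ℤ.+ + x ℤ.+ + y
    lex : (l + at α x) * D + y < (k + at α y) * D + x ⇔ (l + at α x , y) <ₗₑₓ (k + at α y , x)
    lex = *+-<⇔<ₗₑₓ (l + at α x) (k + at α y) (s≤s y≤N) (s≤s x≤N)
    offsetˣ : scaled x k ℤ.+ c ≡ + ((l + at α x) * D + y)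
    offsetˣ = trans (cong (ℤ._+ c) (scaled-def x k))
                    (trans (ring (+ at α x) (+ x) (+ k) (+ y) (+ l) (+ D)) (sym (pos-[l+a]*d+u l (at α x) D y)))
      where
      ring : ∀ a x k y l d → (a ℤ.- k) ℤ.* d ℤ.- x ℤ.+ ((k ℤ.+ l) ℤ.* d ℤ.+ x ℤ.+ y) ≡ (l ℤ.+ a) ℤ.* d ℤ.+ y
      ring = solve-∀
    offsetʸ : scaled y l ℤ.+ c ≡ + ((k + at α y) * D + x)
    offsetʸ = trans (cong (ℤ._+ c) (scaled-def y l))
                    (trans (ring (+ at α y) (+ x) (+ k) (+ y) (+ l) (+ D)) (sym (pos-[l+a]*d+u k (at α y) D x)))
      where
      ring : ∀ b x k y l d → (b ℤ.- l) ℤ.* d ℤ.- y ℤ.+ ((k ℤ.+ l) ℤ.* d ℤ.+ x ℤ.+ y) ≡ (k ℤ.+ b) ℤ.* d ℤ.+ x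
      ring = solve-∀

  scaled-<⇒≤ : ∀ {x k y} → x ≤ N → y ≤ N → scaled y 0 ℤ.< scaled x k → k ≤ at α x
  scaled-<⇒≤ {x} {k} {y} x≤N y≤N lt with Equivalence.to (scaled-<⇔<ₗₑₓ y≤N x≤N) lt
  ... | inj₁ k+b<a       = ≤-trans (m≤m+n k (at α y)) (<⇒≤ k+b<a)
  ... | inj₂ (k+b≡a , _) = ≤-trans (m≤m+n k (at α y)) (≤-reflexive k+b≡a)

  scaled-+ : ∀ x k c → scaled x (k + c) ≡ scaled x k ℤ.- + c ℤ.* + suc N
  scaled-+ x k c = begin
    scaled x (k + c)                                   ≡⟨ scaled-def x (k + c) ⟩
    (+ at α x ℤ.- + (k + c)) ℤ.* D ℤ.- + x             ≡⟨ cong (λ t → (+ at α x ℤ.- t) ℤ.* D ℤ.- + x) (ℤP.pos-+ k c) ⟩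
    (+ at α x ℤ.- (+ k ℤ.+ + c)) ℤ.* D ℤ.- + x         ≡⟨ ring (+ at α x) (+ k) (+ c) (+ x) D ⟩
    (+ at α x ℤ.- + k) ℤ.* D ℤ.- + x ℤ.- + c ℤ.* D     ≡⟨ cong (ℤ._- + c ℤ.* D) (scaled-def x k) ⟨
    scaled x k ℤ.- + c ℤ.* D                           ∎
    where
    open ≡-Reasoning
    D : ℤ
    D = + suc N
    ring : ∀ a k c x d → (a ℤ.- (k ℤ.+ c)) ℤ.* d ℤ.- x ≡ (a ℤ.- k) ℤ.* d ℤ.- x ℤ.- c ℤ.* d
    ring = solve-∀

  scaled-<-shift : ∀ {x k y l} c → scaled x k ℤ.< scaled y l → scaled x (k + c) ℤ.< scaled y (l + c)
  scaled-<-shift {x} {k} {y} {l} c lt =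
    subst₂ ℤ._<_ (sym (scaled-+ x k c)) (sym (scaled-+ y l c)) (ℤP.+-monoˡ-< (ℤ.- (+ c ℤ.* + suc N)) lt)

  countAbove : ℕ → ℕ → ℕ
  countAbove x k = count (λ j → does (scaled x k ℤ.<? scaled j 0)) N

  private
    above? : ∀ x k j → Reflects (scaled x k ℤ.< scaled j 0) (does (scaled x k ℤ.<? scaled j 0))
    above? x k j = proof (scaled x k ℤ.<? scaled j 0)

    at? : ∀ x j → Reflects (j ≡ x) (j ≡ᵇ x)
    at? x j = ≡ᵇ-reflects-≡ j x

    count-at : ∀ {x} → 1 ≤ x → x ≤ N → count (_≡ᵇ x) N ≡ 1
    count-at = count-≡ᵇ N

    after before inLeg : ℕ → ℕ → ℕ → Bool
    after  x t j = (x <ᵇ j) ∧ ((t ≤ᵇ at α j) ∧ (at α j ≤ᵇ at α x))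
    before x t j = (j <ᵇ x) ∧ ((t ≤ᵇ suc (at α j)) ∧ (suc (at α j) ≤ᵇ at α x))
    inLeg  x t j = after x t j ∨ before x t j

    after? : ∀ x t j → Reflects (x < j × (t ≤ at α j × at α j ≤ at α x)) (after x t j)
    after? x t j =
      <ᵇ-reflects-< x j ×-reflects (≤ᵇ-reflects-≤ t (at α j) ×-reflects ≤ᵇ-reflects-≤ (at α j) (at α x))

    before? : ∀ x t j → Reflects (j < x × (t ≤ suc (at α j) × suc (at α j) ≤ at α x)) (before x t j)
    before? x t j =
      <ᵇ-reflects-< j x ×-reflects (≤ᵇ-reflects-≤ t (suc (at α j)) ×-reflects ≤ᵇ-reflects-≤ (suc (at α j)) (at α x))

    inLeg? : ∀ x t j → Reflects (LegCondition x j (at α x) (at α j) t) (inLeg x t j)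
    inLeg? x t j = after? x t j ⊎-reflects before? x t j

    leg≡count-inLeg : ∀ x t → leg α x t ≡ count (inLeg x t) N
    leg≡count-inLeg x t = count-∨ (after? x t) (before? x t) N (λ _ (x<j , _) (j<x , _) → <-asym x<j j<x)

  rank≡suc-countAbove : ∀ {x} → 1 ≤ x → x ≤ N → rank α x ≡ suc (countAbove x 0)
  rank≡suc-countAbove {x} 1≤x x≤N = begin
    rank α x
      ≡⟨ count-∨ higher? level? N (λ _ a<b (_ , b≡a) → <-irrefl (sym b≡a) a<b) ⟩
    count (λ j → (at α x <ᵇ at α j) ∨ ((j ≤ᵇ x) ∧ (at α j ≡ᵇ at α x))) N
      ≡⟨ count-cong (λ j → higher? j ⊎-reflects level? j) (λ j → above? x 0 j ⊎-reflects at? x j) N conditions⇔ ⟩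
    count (λ j → does (scaled x 0 ℤ.<? scaled j 0) ∨ (j ≡ᵇ x)) N
      ≡⟨ count-∨ (above? x 0) (at? x) N (λ { _ lt refl → ℤP.<-irrefl refl lt }) ⟨
    countAbove x 0 + count (_≡ᵇ x) N
      ≡⟨ cong (λ c → countAbove x 0 + c) (count-at 1≤x x≤N) ⟩
    countAbove x 0 + 1
      ≡⟨ +-comm (countAbove x 0) 1 ⟩
    suc (countAbove x 0) ∎
    where
    open ≡-Reasoning
    higher? : ∀ j → Reflects (at α x < at α j) (at α x <ᵇ at α j)
    higher? j = <ᵇ-reflects-< (at α x) (at α j)
    level? : ∀ j → Reflects (j ≤ x × at α j ≡ at α x) ((j ≤ᵇ x) ∧ (at α j ≡ᵇ at α x))
    level? j = ≤ᵇ-reflects-≤ j x ×-reflects ≡ᵇ-reflects-≡ (at α j) (at α x)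
    conditions⇔ : ∀ {j} → j ≤ N →
      (at α x < at α j ⊎ (j ≤ x × at α j ≡ at α x)) ⇔ (scaled x 0 ℤ.< scaled j 0 ⊎ j ≡ x)
    conditions⇔ j≤N = mk⇔ (Sum.map₁ (Equivalence.from lex) ∘ Equivalence.to rank⇔)
                          (Equivalence.from rank⇔ ∘ Sum.map₁ (Equivalence.to lex))
      where
      lex = scaled-<⇔<ₗₑₓ x≤N j≤N
      rank⇔ = rank-condition⇔ (cong (at α))

  leg+rank≡countAbove : ∀ {x k} → 1 ≤ x → x ≤ N → 1 ≤ k →
                        leg α x (at α x + 1 ∸ k) + rank α x ≡ countAbove x k
  leg+rank≡countAbove {x} {k} 1≤x x≤N 1≤k = begin
    leg α x t + rank α x
      ≡⟨ cong₂ _+_ (leg≡count-inLeg x t) (rank≡suc-countAbove 1≤x x≤N) ⟩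
    count (inLeg x t) N + suc (countAbove x 0)
      ≡⟨ cong (λ c → count (inLeg x t) N + (c + countAbove x 0)) (count-at 1≤x x≤N) ⟨
    count (inLeg x t) N + (count (_≡ᵇ x) N + countAbove x 0)
      ≡⟨ +-assoc (count (inLeg x t) N) (count (_≡ᵇ x) N) (countAbove x 0) ⟨
    count (inLeg x t) N + count (_≡ᵇ x) N + countAbove x 0
      ≡⟨ cong (_+ countAbove x 0) (count-∨ (inLeg? x t) (at? x) N inLeg-disjoint-at) ⟩
    count (λ j → inLeg x t j ∨ (j ≡ᵇ x)) N + countAbove x 0
      ≡⟨ count-∨ (λ j → inLeg? x t j ⊎-reflects at? x j) (above? x 0) N inLeg-or-at-disjoint-above ⟩
    count (λ j → (inLeg x t j ∨ (j ≡ᵇ x)) ∨ does (scaled x 0 ℤ.<? scaled j 0)) N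
      ≡⟨ count-cong (λ j → (inLeg? x t j ⊎-reflects at? x j) ⊎-reflects above? x 0 j) (above? x k) N conditions⇔ ⟩
    countAbove x k ∎
    where
    open ≡-Reasoning
    t : ℕ
    t = at α x + 1 ∸ k
    inLeg-disjoint-at : ∀ {j} → j ≤ N → LegCondition x j (at α x) (at α j) t → j ≢ x
    inLeg-disjoint-at _ (inj₁ (x<j , _)) refl = <-irrefl refl x<j
    inLeg-disjoint-at _ (inj₂ (j<x , _)) refl = <-irrefl refl j<x
    inLeg-or-at-disjoint-above : ∀ {j} → j ≤ N → LegCondition x j (at α x) (at α j) t ⊎ j ≡ x →
                                 ¬ scaled x 0 ℤ.< scaled j 0
    inLeg-or-at-disjoint-above j≤N (inj₁ c) lt = leg-condition-disjoint c (Equivalence.to (scaled-<⇔<ₗₑₓ x≤N j≤N) lt)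
    inLeg-or-at-disjoint-above _ (inj₂ refl) lt = ℤP.<-irrefl refl lt
    conditions⇔ : ∀ {j} → j ≤ N →
      ((LegCondition x j (at α x) (at α j) t ⊎ j ≡ x) ⊎ scaled x 0 ℤ.< scaled j 0) ⇔ scaled x k ℤ.< scaled j 0
    conditions⇔ {j} j≤N = mk⇔
      (Equivalence.from lexᵏ ∘ leg-condition⊎⇒<ₗₑₓ 1≤k (cong (at α)) ∘ Sum.map₂ (Equivalence.to lex⁰))
      (Sum.map₂ (Equivalence.from lex⁰) ∘ <ₗₑₓ⇒leg-condition⊎ 1≤k (cong (at α)) ∘ Equivalence.to lexᵏ)
      where
      lex⁰ : scaled x 0 ℤ.< scaled j 0 ⇔ (at α x , j) <ₗₑₓ (at α j , x)
      lex⁰ = scaled-<⇔<ₗₑₓ x≤N j≤N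
      lexᵏ : scaled x k ℤ.< scaled j 0 ⇔ (at α x , j) <ₗₑₓ (k + at α j , x)
      lexᵏ = scaled-<⇔<ₗₑₓ x≤N j≤N

  rank≤countAbove⇔ : ∀ {x k y} → 1 ≤ y → y ≤ N → rank α y ≤ countAbove x k ⇔ scaled x k ℤ.< scaled y 0
  rank≤countAbove⇔ {x} {k} {y} 1≤y y≤N = mk⇔ to from
    where
    to : rank α y ≤ countAbove x k → scaled x k ℤ.< scaled y 0
    to r≤c with scaled x k ℤ.<? scaled y 0
    ... | yes lt = lt
    ... | no ¬lt = contradiction r≤c (<⇒≱ (begin-strict
      countAbove x k        ≤⟨ count-mono (above? x k) (above? y 0) N (λ _ → ℤP.≤-<-trans (ℤP.≮⇒≥ ¬lt)) ⟩
      countAbove y 0        <⟨ n<1+n (countAbove y 0) ⟩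
      suc (countAbove y 0)  ≡⟨ rank≡suc-countAbove 1≤y y≤N ⟨
      rank α y              ∎))
      where open ≤-Reasoning
    from : scaled x k ℤ.< scaled y 0 → rank α y ≤ countAbove x k
    from lt = begin
      rank α y
        ≡⟨ rank≡suc-countAbove 1≤y y≤N ⟩
      suc (countAbove y 0)
        ≡⟨ cong (_+ countAbove y 0) (count-at 1≤y y≤N) ⟨
      count (_≡ᵇ y) N + countAbove y 0
        ≡⟨ count-∨ (at? y) (above? y 0) N (λ { _ refl lt′ → ℤP.<-irrefl refl lt′ }) ⟩
      count (λ j → (j ≡ᵇ y) ∨ does (scaled y 0 ℤ.<? scaled j 0)) N
        ≤⟨ count-mono (λ j → at? y j ⊎-reflects above? y 0 j) (above? x k) N
                      (λ _ → Sum.[ (λ { refl → lt }) , ℤP.<-trans lt ]) ⟩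
      countAbove x k ∎
      where open ≤-Reasoning

  countAbove<rank : ∀ {x k y} → 1 ≤ y → y ≤ N → scaled y 0 ℤ.< scaled x k → countAbove x k < rank α y
  countAbove<rank {x} {k} 1≤y y≤N lt = ≰⇒> (ℤP.<-asym lt ∘ Equivalence.to (rank≤countAbove⇔ {x} {k} 1≤y y≤N))

ξ≡αt-shift : ∀ {N} (α : Vec ℕ N) w n M r q {p} → p ≡ suc (r + q * suc M) → r < suc M →
      ξ α w n M p ≡ αt α (w (suc r)) ℚ.- + (n * q) ℚ./ 1
ξ≡αt-shift α w n M r q refl r<1+M =
  cong₂ (λ r′ q′ → αt α (w (suc r′)) ℚ.- + (n * q′) ℚ./ 1) remainder quotient
  where
  remainder : (r + q * suc M) % suc M ≡ r
  remainder = trans ([m+kn]%n≡m%n r q (suc M)) (m<n⇒m%n≡m r<1+M)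
  quotient : (r + q * suc M) / suc M ≡ q
  quotient = trans (+-distrib-/-∣ʳ r (divides q refl)) (cong₂ _+_ (m<n⇒m/n≡0 r<1+M) (m*n/n≡m q (suc M)))

[a-[a+1∸k]]+1≡k : ∀ {a k} → k ≤ a → (+ a ℤ.- + (a + 1 ∸ k)) ℤ.+ + 1 ≡ + k
[a-[a+1∸k]]+1≡k {a} {k} k≤a = begin
  + a ℤ.- + t ℤ.+ + 1      ≡⟨ ring (+ a) (+ t) ⟩
  + (a + 1) ℤ.- + t        ≡⟨ cong (λ c → + c ℤ.- + t) (m∸n+n≡m (m≤n⇒m≤n+o 1 k≤a)) ⟨
  + (t + k) ℤ.- + t        ≡⟨ ring′ (+ t) (+ k) ⟩
  + k                      ∎
  where
  open ≡-Reasoning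
  t = a + 1 ∸ k
  ring : ∀ a t → a ℤ.- t ℤ.+ ℤ.1ℤ ≡ a ℤ.+ ℤ.1ℤ ℤ.- t
  ring = solve-∀
  ring′ : ∀ t k → t ℤ.+ k ℤ.- t ≡ k
  ring′ = solve-∀

m+s+2≡suc[i+l*m] : ∀ M s l i → M + 1 + s + 1 ≡ (M + 1) * l + i → M + 1 + s + 2 ≡ suc (i + l * suc M)
m+s+2≡suc[i+l*m] M s l i p≡ml+i = begin
  M + 1 + s + 2          ≡⟨ ring₁ M s ⟩
  suc (M + 1 + s + 1)    ≡⟨ cong suc p≡ml+i ⟩
  suc ((M + 1) * l + i)  ≡⟨ ring₂ M l i ⟩
  suc (i + l * suc M)    ∎
  where
  open ≡-Reasoning
  ring₁ : ∀ M s → M + 1 + s + 2 ≡ suc (M + 1 + s + 1)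
  ring₁ = ℕ-Ring.solve-∀
  ring₂ : ∀ M l i → suc ((M + 1) * l + i) ≡ suc (i + l * suc M)
  ring₂ = ℕ-Ring.solve-∀

m+s+1≡m*l+i⇒1≤l : ∀ {m s l i} → m + s + 1 ≡ m * l + i → i ≤ m → 1 ≤ l
m+s+1≡m*l+i⇒1≤l {m} {s} {zero} {i} p≡ml+i i≤m =
  contradiction (subst (_≤ m) (sym (trans p≡ml+i (cong (_+ i) (*-zeroʳ m)))) i≤m)
                (<⇒≱ (≤-<-trans (m≤m+n m s) (m<m+n (m + s) z<s)))
m+s+1≡m*l+i⇒1≤l {l = suc l} _ _ = s≤s z≤n

L+i≡m+s⇒1+L≡l*m : ∀ {L i m s l} → L + i ≡ m + s → m + s + 1 ≡ m * l + i → 1 + L ≡ l * m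
L+i≡m+s⇒1+L≡l*m {L} {i} {m} {s} {l} L+i≡m+s p≡ml+i = +-cancelʳ-≡ i (1 + L) (l * m) (begin
  1 + L + i     ≡⟨ cong suc L+i≡m+s ⟩
  suc (m + s)   ≡⟨ +-comm 1 (m + s) ⟩
  m + s + 1     ≡⟨ p≡ml+i ⟩
  m * l + i     ≡⟨ cong (_+ i) (*-comm m l) ⟩
  l * m + i     ∎)
  where open ≡-Reasoning

module _ {N : ℕ} (α : Vec ℕ N) (w : ℕ → ℕ)
         (ranks : ∀ i → 1 ≤ i → i ≤ N → (1 ≤ w i × w i ≤ N) × rank α (w i) ≡ i) where

  1≤w : ∀ {r} → 1 ≤ r → r ≤ N → 1 ≤ w r
  1≤w {r} 1≤r r≤N = proj₁ (proj₁ (ranks r 1≤r r≤N))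

  w≤N : ∀ {r} → 1 ≤ r → r ≤ N → w r ≤ N
  w≤N {r} 1≤r r≤N = proj₂ (proj₁ (ranks r 1≤r r≤N))

  rank-w : ∀ {r} → 1 ≤ r → r ≤ N → rank α (w r) ≡ r
  rank-w {r} 1≤r r≤N = proj₂ (ranks r 1≤r r≤N)

  ≤countAbove⇔scaled-<-w : ∀ {x k r} → 1 ≤ r → r ≤ N →
                           r ≤ countAbove α x k ⇔ scaled α x k ℤ.< scaled α (w r) 0
  ≤countAbove⇔scaled-<-w {x} {k} {r} 1≤r r≤N =
    subst (λ c → c ≤ countAbove α x k ⇔ scaled α x k ℤ.< scaled α (w r) 0) (rank-w 1≤r r≤N)
          (rank≤countAbove⇔ α {x} {k} (1≤w 1≤r r≤N) (w≤N 1≤r r≤N))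

  scaled-<-w⇒countAbove< : ∀ {x k r} → 1 ≤ r → r ≤ N → scaled α (w r) 0 ℤ.< scaled α x k → countAbove α x k < r
  scaled-<-w⇒countAbove< {x} {k} 1≤r r≤N lt =
    subst (countAbove α x k <_) (rank-w 1≤r r≤N) (countAbove<rank α {x} {k} (1≤w 1≤r r≤N) (w≤N 1≤r r≤N) lt)

  scaled-w-decreasing : ∀ {r} → 1 ≤ r → suc r ≤ N → scaled α (w (suc r)) 0 ℤ.< scaled α (w r) 0
  scaled-w-decreasing {r} 1≤r r<N =
    Equivalence.to (≤countAbove⇔scaled-<-w {w (suc r)} {0} 1≤r (<⇒≤ r<N)) (≤-reflexive r≡countAbove)
    where
    r≡countAbove : r ≡ countAbove α (w (suc r)) 0
    r≡countAbove = suc-injective (trans (sym (rank-w (s≤s z≤n) r<N))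
                                        (rank≡suc-countAbove α (1≤w (s≤s z≤n) r<N) (w≤N (s≤s z≤n) r<N)))

  scaled-w1-shift : ∀ {n M} → 1 ≤ n → leg α (w 1) (at α (w 1) + 1 ∸ n) ≡ M → M + 1 ≤ N →
                    scaled α (w 1) n ℤ.< scaled α (w (M + 1)) 0
  scaled-w1-shift {n} {M} 1≤n refl m≤N =
    Equivalence.to (≤countAbove⇔scaled-<-w {w 1} {n} (m≤n+m 1 M) m≤N) (≤-reflexive m≡countAbove)
    where
    1≤N : 1 ≤ N
    1≤N = ≤-trans (m≤n+m 1 M) m≤N
    m≡countAbove : M + 1 ≡ countAbove α (w 1) n
    m≡countAbove = trans (cong (_+_ M) (sym (rank-w ≤-refl 1≤N)))
                         (leg+rank≡countAbove α (1≤w ≤-refl 1≤N) (w≤N ≤-refl 1≤N) 1≤n)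

  ξ-gap>0⇒scaled-< : ∀ {n M s l i} → M + 1 + s + 1 ≡ (M + 1) * l + i → 1 ≤ i → i ≤ M + 1 →
    0ℚ ℚ.< αt α (w (M + 1 + s)) ℚ.- ξ α w n M (M + 1 + s + 1) →
    scaled α (w i) (n * l) ℤ.< scaled α (w (M + 1 + s)) 0
  ξ-gap>0⇒scaled-< {n} {M} {s} {l} {suc i′} p≡ml+i _ i≤m gap>0 =
    0<αt-[αt-k]⇒scaled-< α {w (suc i′)} {n * l} {w (M + 1 + s)}
      (subst (λ ξ′ → 0ℚ ℚ.< αt α (w (M + 1 + s)) ℚ.- ξ′) ξ≡ gap>0)
    where
    ξ≡ : ξ α w n M (M + 1 + s + 1) ≡ αt α (w (suc i′)) ℚ.- + (n * l) ℚ./ 1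
    ξ≡ = ξ≡αt-shift α w n M i′ l (trans p≡ml+i (ring M l i′)) (subst (suc i′ ≤_) (+-comm M 1) i≤m)
      where
      ring : ∀ M l i′ → (M + 1) * l + suc i′ ≡ suc (i′ + l * suc M)
      ring = ℕ-Ring.solve-∀

  ξ-gap<0⇒scaled-< : ∀ {n M s l i} → 1 ≤ n → leg α (w 1) (at α (w 1) + 1 ∸ n) ≡ M →
    M + 1 + s + 1 ≡ (M + 1) * l + i → 1 ≤ i → i ≤ M + 1 → M + 1 + s + 1 ≤ N →
    αt α (w (M + 1 + s + 1)) ℚ.- ξ α w n M (M + 1 + s + 2) ℚ.< 0ℚ →
    scaled α (w (M + 1 + s + 1)) 0 ℤ.< scaled α (w i) (n * l)
  ξ-gap<0⇒scaled-< {n} {M} {s} {l} {i} 1≤n M≡ p≡ml+i 1≤i i≤m p≤N gap<0 with m≤n⇒m<n∨m≡n i≤m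
  ... | inj₁ i<m =
    ℤP.<-trans (αt-[αt-k]<0⇒scaled-< α {w (suc i)} {n * l} {w (M + 1 + s + 1)}
                 (subst (λ ξ′ → αt α (w (M + 1 + s + 1)) ℚ.- ξ′ ℚ.< 0ℚ) ξ≡ gap<0))
               (scaled-<-shift α (n * l) (scaled-w-decreasing 1≤i (<-≤-trans i<m m≤N)))
    where
    m≤N : M + 1 ≤ N
    m≤N = ≤-trans (≤-trans (m≤m+n (M + 1) s) (m≤m+n (M + 1 + s) 1)) p≤N
    ξ≡ : ξ α w n M (M + 1 + s + 2) ≡ αt α (w (suc i)) ℚ.- + (n * l) ℚ./ 1
    ξ≡ = ξ≡αt-shift α w n M i l (m+s+2≡suc[i+l*m] M s l i p≡ml+i) (subst (i <_) (+-comm M 1) i<m)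
  ... | inj₂ refl =
    ℤP.<-trans (αt-[αt-k]<0⇒scaled-< α {w 1} {n * suc l} {w (M + 1 + s + 1)}
                 (subst (λ ξ′ → αt α (w (M + 1 + s + 1)) ℚ.- ξ′ ℚ.< 0ℚ) ξ≡ gap<0))
               (subst (λ k → scaled α (w 1) k ℤ.< scaled α (w (M + 1)) (n * l)) (sym (*-suc n l))
                      (scaled-<-shift α (n * l) (scaled-w1-shift 1≤n M≡ m≤N)))
    where
    m≤N : M + 1 ≤ N
    m≤N = ≤-trans (≤-trans (m≤m+n (M + 1) s) (m≤m+n (M + 1 + s) 1)) p≤N
    ξ≡ : ξ α w n M (M + 1 + s + 2) ≡ αt α (w 1) ℚ.- + (n * suc l) ℚ./ 1
    ξ≡ = ξ≡αt-shift α w n M 0 (suc l) (trans (m+s+2≡suc[i+l*m] M s l (M + 1) p≡ml+i) (cong suc (ring M l)))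
                    (s≤s z≤n)
      where
      ring : ∀ M l → M + 1 + l * suc M ≡ 0 + suc l * suc M
      ring = ℕ-Ring.solve-∀

  countAbove-between : ∀ {x k r} → 1 ≤ r → r + 1 ≤ N →
    scaled α x k ℤ.< scaled α (w r) 0 → scaled α (w (r + 1)) 0 ℤ.< scaled α x k → countAbove α x k ≡ r
  countAbove-between {x} {k} {r} 1≤r r+1≤N above below = ≤-antisym
    (≤-pred (subst (countAbove α x k <_) (+-comm r 1) (scaled-<-w⇒countAbove< (m≤n+m 1 r) r+1≤N below)))
    (Equivalence.from (≤countAbove⇔scaled-<-w 1≤r (≤-trans (m≤m+n r 1) r+1≤N)) above)

  leg-w≡ : ∀ {i k r} → 1 ≤ i → i ≤ N → 1 ≤ k → 1 ≤ r → r + 1 ≤ N →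
    scaled α (w i) k ℤ.< scaled α (w r) 0 → scaled α (w (r + 1)) 0 ℤ.< scaled α (w i) k →
    leg α (w i) (at α (w i) + 1 ∸ k) + i ≡ r
  leg-w≡ {i} {k} {r} 1≤i i≤N 1≤k 1≤r r+1≤N above below = begin
    L + i                   ≡⟨ cong (_+_ L) (rank-w 1≤i i≤N) ⟨
    L + rank α (w i)        ≡⟨ leg+rank≡countAbove α (1≤w 1≤i i≤N) (w≤N 1≤i i≤N) 1≤k ⟩
    countAbove α (w i) k    ≡⟨ countAbove-between 1≤r r+1≤N above below ⟩
    r                       ∎
    where
    open ≡-Reasoning
    L = leg α (w i) (at α (w i) + 1 ∸ k)


mainTheorem8 :
  (N : ℕ) (α : Vec ℕ N) → N ≡ ell α + size α →
  (w : ℕ → ℕ) →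
  (∀ i → 1 ≤ i → i ≤ N → (1 ≤ w i × w i ≤ N) × rank α (w i) ≡ i) →
  (n : ℕ) → 1 ≤ n → n ≤ at α (w 1) →
  let M = leg α (w 1) (at α (w 1) + 1 ∸ n)
      m = M + 1
  in
  (T : ℕ) → 1 ≤ T → m + T ≤ N →
  (∀ s → 1 ≤ s → s < T → αt α (w (m + s)) <ℚ ξ α w n M (m + s + 1)) →
  αt α (w (m + T)) >ℚ ξ α w n M (m + T + 1) →
  (s : ℕ) → T < s → m + s + 1 ≤ N →
  (αt α (w (m + s)) - ξ α w n M (m + s + 1)) >ℚ 0ℚ →
  (αt α (w (m + s + 1)) - ξ α w n M (m + s + 2)) <ℚ 0ℚ →
  (l i : ℕ) → m + s + 1 ≡ m * l + i → 1 ≤ i → i ≤ m →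
  (n * l ≤ at α (w i))
  × hook α κ+1 (w i) (at α (w i) + 1 ∸ n * l) ≡ (+ (l * n) , + (l * m))
mainTheorem8 N α _ w ranks n 1≤n _ _ _ _ _ _ s _ p≤N gap>0 gap<0 l i p≡ml+i 1≤i i≤m =
  nl≤α , cong₂ _,_ (trans ([a-[a+1∸k]]+1≡k nl≤α) (cong +_ (*-comm n l)))
                   (cong +_ (L+i≡m+s⇒1+L≡l*m {m = M + 1} {s} leg+i≡m+s p≡ml+i))
  where
  M : ℕ
  M = leg α (w 1) (at α (w 1) + 1 ∸ n)
  i≤N : i ≤ N
  i≤N = ≤-trans i≤m (≤-trans (≤-trans (m≤m+n (M + 1) s) (m≤m+n (M + 1 + s) 1)) p≤N)
  -- The leg term is spelled out in the next two calls: matching gap>0 and gap<0 against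
  -- the local M instead would make Agda normalise ξ.
  above : scaled α (w i) (n * l) ℤ.< scaled α (w (M + 1 + s)) 0
  above = ξ-gap>0⇒scaled-< α w ranks {n} {leg α (w 1) (at α (w 1) + 1 ∸ n)} p≡ml+i 1≤i i≤m gap>0
  below : scaled α (w (M + 1 + s + 1)) 0 ℤ.< scaled α (w i) (n * l)
  below = ξ-gap<0⇒scaled-< α w ranks {n} {leg α (w 1) (at α (w 1) + 1 ∸ n)} 1≤n refl p≡ml+i 1≤i i≤m p≤N gap<0
  nl≤α : n * l ≤ at α (w i)
  nl≤α = scaled-<⇒≤ α (w≤N α w ranks 1≤i i≤N) (w≤N α w ranks (m≤n+m 1 (M + 1 + s)) p≤N) below
  leg+i≡m+s : leg α (w i) (at α (w i) + 1 ∸ n * l) + i ≡ M + 1 + s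
  leg+i≡m+s = leg-w≡ α w ranks 1≤i i≤N (*-mono-≤ 1≤n (m+s+1≡m*l+i⇒1≤l {M + 1} {s} p≡ml+i i≤m))
                     (≤-trans (m≤n+m 1 M) (m≤m+n (M + 1) s)) p≤N above below
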